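{- Let $p$ be a prime, $a>0$ an integer, and $n=p^a+1$. Then for every prime $r$ dividing $n$, $n$ satisfies Condition 1 with $p$ and $r$, i.e. for every integer $k$ with $1\le k\le n-1$, $\binom{n}{k}$ is divisible by $p$ or by $r$.
   Context: A positive integer $n$ satisfies Condition 1 with primes $p$ and $q$ if for all integers $k$ with $1\le k\le n-1$ the binomial coefficient $\binom{n}{k}$ is divisible by $p$ or by $q$. -}

module Defs where

open import Data.Nat using (ℕ; _≤_; _∸_)
open import Data.Nat.Divisibility using (_∣_)
open import Data.Nat.Combinatorics using (_C_)
open import Data.Sum using (_⊎_)

Condition1 : ℕ → ℕ → ℕ → Set
Condition1 n p q = ∀ k → 1 ≤ k → k ≤ n ∸ 1 → p ∣ (n C k) ⊎ q ∣ (n C k)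

module Submission where

-- Let q = p ^ a.  The proof combines two facts.
--
-- (1) Every inner binomial coefficient q C k (0 < k < q) of a prime power
--     is divisible by p.  This follows from the absorption identity
--     k · (n C k) = n · ((n-1) C (k-1)), which shows n ∣ k · (n C k):
--     if p did not divide q C k, all of p ^ a would have to divide k,
--     impossible for 0 < k < p ^ a.
--
-- (2) For any q such that p divides all inner q C k, and any r dividing
--     q + 1, the number q + 1 satisfies Condition 1 with p and r:
--     the two outer coefficients (q+1) C 1 = (q+1) C q = q + 1 are
--     divisible by r, and each remaining (q+1) C k is, by Pascal's rule,
--     the sum of two inner coefficients q C (k-1) and q C k.

open import Defs
open import Data.Nat using (ℕ; _+_; _^_; _<_)
open import Data.Nat.Divisibility using (_∣_)
open import Data.Nat.Primality using (Prime)

open import Data.Nat using (zero; suc; _*_; _∸_; _≤_; z≤n; s≤s)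
open import Data.Nat.Properties
  using (+-comm; *-comm; *-zeroʳ; *-identityˡ; *-identityʳ; *-distribˡ-+; +-assoc;
         *-commutativeSemigroup; m≤n⇒m<n∨m≡n; <-trans; n<1+n; n≤1+n; m+n∸n≡m)
open import Data.Nat.Divisibility
  using (divides; _∣?_; ∣-trans; ∣m∣n⇒∣m+n; m∣m*n; 1∣_; _∣0;
         *-monoˡ-∣; *-cancelʳ-∣; >⇒∤)
open import Data.Nat.Primality using (euclidsLemma; prime⇒nonZero)
open import Data.Nat.Combinatorics
  using (_C_; nC1≡n; nCn≡1; nCk≡nC[n∸k]; nCk+nC[k+1]≡[n+1]C[k+1])
open import Data.Nat.Combinatorics.Specification using (k>n⇒nCk≡0)
open import Algebra.Properties.CommutativeSemigroup *-commutativeSemigroup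
  using (xy∙z≈xz∙y)
open import Data.Sum using (inj₁; inj₂)
open import Data.Empty using (⊥-elim)
open import Relation.Nullary using (¬_; yes; no)
open import Relation.Binary.PropositionalEquality
  using (_≡_; refl; sym; trans; cong; subst; subst₂; module ≡-Reasoning)

nC0≡1 : ∀ n → n C 0 ≡ 1
nC0≡1 n = trans (nCk≡nC[n∸k] {n = n} z≤n) (nCn≡1 n)

absorption : ∀ n k → suc k * (suc n C suc k) ≡ suc n * (n C k)
absorption n zero = begin
    1 * (suc n C 1)  ≡⟨ *-identityˡ (suc n C 1) ⟩
    suc n C 1        ≡⟨ nC1≡n (suc n) ⟩
    suc n            ≡⟨ sym (*-identityʳ (suc n)) ⟩
    suc n * 1        ≡⟨ cong (suc n *_) (sym (nC0≡1 n)) ⟩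
    suc n * (n C 0)  ∎
  where open ≡-Reasoning
absorption zero (suc k) = begin
    suc (suc k) * (1 C suc (suc k))  ≡⟨ cong (suc (suc k) *_) 1C[2+k]≡0 ⟩
    suc (suc k) * 0                  ≡⟨ *-zeroʳ (suc (suc k)) ⟩
    0                                ≡⟨ cong (1 *_) (sym 0C[1+k]≡0) ⟩
    1 * (0 C suc k)                  ∎
  where
    open ≡-Reasoning
    1C[2+k]≡0 : 1 C suc (suc k) ≡ 0
    1C[2+k]≡0 = k>n⇒nCk≡0 {n = 1} {k = suc (suc k)} (s≤s (s≤s z≤n))
    0C[1+k]≡0 : 0 C suc k ≡ 0
    0C[1+k]≡0 = k>n⇒nCk≡0 {n = 0} {k = suc k} (s≤s z≤n)
absorption (suc n) (suc k) = begin
    suc (suc k) * (suc (suc n) C suc (suc k))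
      ≡⟨ cong (suc (suc k) *_) (sym (nCk+nC[k+1]≡[n+1]C[k+1] (suc n) (suc k))) ⟩
    suc (suc k) * (x + y)
      ≡⟨ *-distribˡ-+ (suc (suc k)) x y ⟩
    (x + suc k * x) + suc (suc k) * y
      ≡⟨ cong ((x + suc k * x) +_) (absorption n (suc k)) ⟩
    (x + suc k * x) + suc n * v
      ≡⟨ cong (λ z → (x + z) + suc n * v) (absorption n k) ⟩
    (x + suc n * u) + suc n * v
      ≡⟨ +-assoc x (suc n * u) (suc n * v) ⟩
    x + (suc n * u + suc n * v)
      ≡⟨ cong (x +_) (sym (*-distribˡ-+ (suc n) u v)) ⟩
    x + suc n * (u + v)
      ≡⟨ cong (λ z → x + suc n * z) (nCk+nC[k+1]≡[n+1]C[k+1] n k) ⟩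
    x + suc n * x
      ∎
  where
    open ≡-Reasoning
    x = suc n C suc k
    y = suc n C suc (suc k)
    u = n C k
    v = n C suc k

n∣k*nCk : ∀ n k → n ∣ k * (n C k)
n∣k*nCk n       zero    = n ∣0
n∣k*nCk zero    (suc k) = subst (0 ∣_) (sym k*0Ck≡0) (0 ∣0)
  where
    k*0Ck≡0 : suc k * (0 C suc k) ≡ 0
    k*0Ck≡0 = trans (cong (suc k *_) (k>n⇒nCk≡0 {n = 0} {k = suc k} (s≤s z≤n))) (*-zeroʳ (suc k))
n∣k*nCk (suc n) (suc k) = subst (suc n ∣_) (sym (absorption n k)) (m∣m*n (n C k))

primePower∣-cancelʳ : ∀ {p} → Prime p → ∀ i {m n} → ¬ p ∣ n → p ^ i ∣ m * n → p ^ i ∣ m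
primePower∣-cancelʳ pp zero _ _ = 1∣ _
primePower∣-cancelʳ {p} pp (suc i) {m} {n} p∤n pⁱ⁺¹∣mn
  with euclidsLemma m n pp (∣-trans (m∣m*n (p ^ i)) pⁱ⁺¹∣mn)
... | inj₂ p∣n = ⊥-elim (p∤n p∣n)
... | inj₁ (divides t refl) = subst (_∣ t * p) (*-comm (p ^ i) p) (*-monoˡ-∣ p pⁱ∣t)
  where
    instance _ = prime⇒nonZero pp
    pⁱp∣tnp : p ^ i * p ∣ t * n * p
    pⁱp∣tnp = subst₂ _∣_ (*-comm p (p ^ i)) (xy∙z≈xz∙y t p n) pⁱ⁺¹∣mn
    pⁱ∣t : p ^ i ∣ t
    pⁱ∣t = primePower∣-cancelʳ pp i p∤n (*-cancelʳ-∣ p pⁱp∣tnp)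

-- A prime p divides every inner binomial coefficient of a power of p:
-- otherwise p ^ a ∣ k · (p ^ a C k) would force p ^ a ∣ k with 0 < k < p ^ a.
prime∣primePowerCk : ∀ {p} → Prime p → ∀ a k → 0 < k → k < p ^ a → p ∣ p ^ a C k
prime∣primePowerCk {p} pp a k@(suc _) _ k<pᵃ with p ∣? (p ^ a C k)
... | yes p∣C = p∣C
... | no  p∤C = ⊥-elim (>⇒∤ k<pᵃ (primePower∣-cancelʳ pp a p∤C (n∣k*nCk (p ^ a) k)))

[1+q]Cq≡1+q : ∀ q → suc q C q ≡ suc q
[1+q]Cq≡1+q q = begin
    suc q C q            ≡⟨ nCk≡nC[n∸k] {n = suc q} (n≤1+n q) ⟩
    suc q C (suc q ∸ q)  ≡⟨ cong (suc q C_) (m+n∸n≡m 1 q) ⟩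
    suc q C 1            ≡⟨ nC1≡n (suc q) ⟩
    suc q                ∎
  where open ≡-Reasoning

-- If p divides every inner coefficient q C k and r divides q + 1, then
-- q + 1 satisfies Condition 1 with p and r: r handles the outer coefficients
-- (q+1) C 1 and (q+1) C q, Pascal's rule reduces the others to row q.
condition1-succ : ∀ q p r → (∀ k → 0 < k → k < q → p ∣ q C k) → r ∣ suc q →
                  Condition1 (suc q) p r
condition1-succ q p r p∣inner r∣1+q (suc zero) _ _ =
  inj₂ (subst (r ∣_) (sym (nC1≡n (suc q))) r∣1+q)
condition1-succ q p r p∣inner r∣1+q (suc (suc j)) _ 2+j≤q with m≤n⇒m<n∨m≡n 2+j≤q
... | inj₂ refl = inj₂ (subst (r ∣_) (sym ([1+q]Cq≡1+q q)) r∣1+q)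
... | inj₁ 2+j<q = inj₁ (subst (p ∣_) (nCk+nC[k+1]≡[n+1]C[k+1] q (suc j))
        (∣m∣n⇒∣m+n (p∣inner (suc j) (s≤s z≤n) (<-trans (n<1+n (suc j)) 2+j<q))
                    (p∣inner (suc (suc j)) (s≤s z≤n) 2+j<q)))

-- Proposition 2.2: for n = p ^ a + 1 and any r dividing n, every inner
-- binomial coefficient of n is divisible by p or by r.
proposition2p2 : ∀ (p a r : ℕ) → Prime p → 0 < a → Prime r → r ∣ (p ^ a + 1) →
    Condition1 (p ^ a + 1) p r
proposition2p2 p a r pp _ _ r∣n =
  subst (λ n → Condition1 n p r) (+-comm 1 (p ^ a))
    (condition1-succ (p ^ a) p r (prime∣primePowerCk pp a)
      (subst (r ∣_) (+-comm (p ^ a) 1) r∣n))
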